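{- For every $n\ge1$ and every $r\ge0$, the number of $\pi\in\Pi_n^0$ with exactly $r$ merging blocks equals the number of $\pi\in\Pi_n^0$ with exactly $r$ normal merging blocks.
   Context: Let $[n]=\{1,\dots,n\}$, $\langle n\rangle=\{0,\pm1,\dots,\pm n\}$. $\Pi_n^0$ is the set of type $B$ set partitions of $\langle n\rangle$ without zero block, encoded in standard form as $\pi=\pi_1\mid\cdots\mid\pi_k$: nonempty sets of nonzero integers with the sets $|\pi_i|=\{|a|:a\in\pi_i\}$ partitioning $[n]$, the element of smallest absolute value $m_i$ of $\pi_i$ positive, and $m_1<\cdots<m_k$. For $2\le i\le k$, $\pi_i$ is a merging block if $\max|\pi_{i-1}|<\min|\pi_i|$, and a normal merging block if $\max(\pi_{i-1})<\min(\pi_i)$, where $\max,\min$ are taken in the usual order of the integers (signed values). -}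

module Defs where

open import Data.Nat using (ℕ; zero; suc; _⊔_; _⊓_) renaming (_<_ to _<ℕ_)
open import Data.Integer using (ℤ; ∣_∣; 0ℤ; +_) renaming (_<_ to _<ℤ_; _⊔_ to _⊔ℤ_; _⊓_ to _⊓ℤ_)
import Data.Nat.Properties as ℕP
import Data.Integer.Properties as ℤP
open import Data.List using (List; []; _∷_; map; concatMap; upTo; length)
open import Data.List.Relation.Unary.All using (All)
open import Data.List.Relation.Unary.Any using (Any)
open import Data.List.Relation.Unary.Linked using (Linked)
open import Data.List.Relation.Binary.Permutation.Propositional using (_↭_)
open import Data.Product using (_×_; Σ)
open import Relation.Nullary using (yes; no; ¬_)
open import Relation.Binary using (Rel; Decidable)

-- A block is a finite set of nonzero integers, represented canonically
-- as a strictly increasing list of integers.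
Block : Set
Block = List ℤ

SPart : Set
SPart = List Block

NonEmpty : Block → Set
NonEmpty [] = Data.Empty.⊥ where import Data.Empty
NonEmpty (_ ∷ _) = Data.Unit.⊤ where import Data.Unit

-- smallest absolute value of a block (0 for the empty block; irrelevant)
minAbs : Block → ℕ
minAbs [] = 0
minAbs (x ∷ xs) = go ∣ x ∣ xs
  where
  go : ℕ → List ℤ → ℕ
  go acc [] = acc
  go acc (y ∷ ys) = go (acc ⊓ ∣ y ∣) ys

maxAbs : Block → ℕ
maxAbs [] = 0
maxAbs (x ∷ xs) = go ∣ x ∣ xs
  where
  go : ℕ → List ℤ → ℕ
  go acc [] = acc
  go acc (y ∷ ys) = go (acc ⊔ ∣ y ∣) ys

minℤ : Block → ℤ
minℤ [] = 0ℤ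
minℤ (x ∷ xs) = go x xs
  where
  go : ℤ → List ℤ → ℤ
  go acc [] = acc
  go acc (y ∷ ys) = go (acc ⊓ℤ y) ys

maxℤ : Block → ℤ
maxℤ [] = 0ℤ
maxℤ (x ∷ xs) = go x xs
  where
  go : ℤ → List ℤ → ℤ
  go acc [] = acc
  go acc (y ∷ ys) = go (acc ⊔ℤ y) ys

MinAbsPositive : Block → Set
MinAbsPositive B = Any (λ a → (0ℤ <ℤ a) × All (λ b → ∣ a ∣ Data.Nat.≤ ∣ b ∣) B) B
  where import Data.Nat

-- Standard form of an element of Π_n^0:
--  * every block is nonempty and listed in strictly increasing order
--    (canonical representation of a set);
--  * the absolute values of all entries, taken together, are exactly
--    1,…,n each once (so the sets |πᵢ| partition [n], no zero, and no
--    block contains both a and -a);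
--  * in every block the element of smallest absolute value is positive;
--  * blocks are ordered by increasing m_i = min |πᵢ|.
StdForm : ℕ → SPart → Set
StdForm n π =
  All (λ B → NonEmpty B × Linked _<ℤ_ B) π
  × (concatMap (map ∣_∣) π ↭ map suc (upTo n))
  × All MinAbsPositive π
  × Linked (λ B C → minAbs B <ℕ minAbs C) π

-- Number of indices i ≥ 2 such that R π_{i-1} π_i holds.
countAdj : {A : Set} {R : Rel A Agda.Primitive.lzero} → Decidable R → List A → ℕ
countAdj R? [] = 0
countAdj R? (x ∷ xs) = go x xs
  where
  go : _ → List _ → ℕ
  go prev [] = 0
  go prev (y ∷ ys) with R? prev y
  ... | yes _ = suc (go y ys)
  ... | no  _ = go y ys

MergeRel : Rel Block Agda.Primitive.lzero
MergeRel B C = maxAbs B <ℕ minAbs C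

NormalMergeRel : Rel Block Agda.Primitive.lzero
NormalMergeRel B C = maxℤ B <ℤ minℤ C

mergeCount : SPart → ℕ
mergeCount = countAdj {R = MergeRel} (λ B C → maxAbs B ℕP.<? minAbs C)

normalMergeCount : SPart → ℕ
normalMergeCount = countAdj {R = NormalMergeRel} (λ B C → maxℤ B ℤP.<? minℤ C)

-- Write a negative entry as -a and let c(a) be the number of blocks whose least absolute
-- value mᵢ is below a. As m₁ < ⋯ < mₖ these are the first c(a) blocks, and -a lies in one of
-- them, since the element of least absolute value of its block is positive. Moving every
-- negative entry -a one block to the right, cyclically within the first c(a) blocks, keeps
-- every mᵢ; hence it maps Π_n^0 to itself, with the cyclic move to the left as inverse.
-- Block πᵢ₊₁ is merging in π exactly when it is a normal merging block of the image: if
-- max |πᵢ| < mᵢ₊₁, no negative entry moves into block i+1 and all entries left in block i are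
-- below mᵢ₊₁; conversely, an entry -a ∈ πᵢ with a > mᵢ₊₁ would move into block i+1 and lie
-- below the positive entry mᵢ of block i.
module Submission where

open import Defs
open import Data.Nat using (ℕ; _≤_)
open import Data.List using (List; length)
open import Data.List.Relation.Unary.Unique.Propositional using (Unique)
open import Data.List.Membership.Propositional using (_∈_)
open import Data.Product using (_×_)
open import Function.Bundles using (_⇔_)
open import Relation.Binary.PropositionalEquality using (_≡_)

open import Algebra.Construct.NaturalChoice.Base using (MinOperator; MaxOp⇒MinOp)
import Algebra.Construct.NaturalChoice.MinOp as MinOp
open import Data.Empty using (⊥-elim)
open import Data.Integer using (ℤ; +_; -[1+_]; ∣_∣)
import Data.Integer as ℤ
import Data.Integer.Properties as ℤP
open import Data.List using ([]; _∷_; _++_; map; concatMap; filter; foldl; upTo; applyUpTo; applyDownFrom)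
open import Data.List.Properties using (length-map; length-applyUpTo; foldl-map)
open import Data.List.Membership.Propositional using (find; lose)
open import Data.List.Membership.Propositional.Properties
  using ( ∈-map⁺; ∈-map⁻; ∈-++⁺ˡ; ∈-++⁺ʳ; ∈-++⁻; ∈-upTo⁺; ∈-upTo⁻
        ; ∈-applyUpTo⁺; ∈-applyUpTo⁻; ∈-applyDownFrom⁺; ∈-applyDownFrom⁻; ∈-filter⁺; ∈-filter⁻)
open import Data.List.Membership.Propositional.Properties.WithK using (unique∧set⇒bag)
open import Data.List.Membership.DecPropositional ℤP._≟_ using (_∈?_)
open import Data.List.Relation.Binary.BagAndSetEquality using (∼bag⇒↭)
open import Data.List.Relation.Binary.Disjoint.Propositional using (Disjoint)
open import Data.List.Relation.Binary.Equality.Propositional using (≋⇒≡)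
open import Data.List.Relation.Binary.Permutation.Propositional using (_↭_; ↭-sym; ↭⇒↭ₛ)
open import Data.List.Relation.Binary.Permutation.Propositional.Properties using (↭-length; ∈-resp-↭)
import Data.List.Relation.Binary.Permutation.Setoid.Properties as PermutationSetoid
open import Data.List.Relation.Unary.All as All using (All; []; _∷_)
import Data.List.Relation.Unary.All.Properties as AllP
open import Data.List.Relation.Unary.AllPairs as AllPairs using (AllPairs; []; _∷_)
import Data.List.Relation.Unary.AllPairs.Properties as AllPairsP
open import Data.List.Relation.Unary.Any using (Any; here; there)
open import Data.List.Relation.Unary.Linked as Linked using (Linked; []; [-]; _∷_)
open import Data.List.Relation.Unary.Linked.Properties using (Linked⇒AllPairs; AllPairs⇒Linked)
open import Data.List.Relation.Unary.Sorted.TotalOrder.Properties using (↗↭↗⇒≋)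
import Data.List.Relation.Unary.Unique.Propositional.Properties as UniqueP
open import Data.Nat using (zero; suc; _<_; _∸_; z≤n; s≤s; _<?_)
import Data.Nat as ℕ
import Data.Nat.Properties as ℕP
open import Data.Product using (_,_; proj₁; proj₂; ∃-syntax)
open import Data.Sum using (inj₁; inj₂)
open import Function.Base using (_∘_)
open import Function.Bundles using (mk⇔; Equivalence)
open import Function.Construct.Composition using (_⇔-∘_)
open import Level using (0ℓ)
open import Relation.Binary using (Rel; Decidable; TotalPreorder; tri<; tri≈; tri>)
open import Relation.Binary.Construct.Flip.EqAndOrd using () renaming (totalPreorder to flipOrder)
open import Relation.Binary.PropositionalEquality
  using (_≢_; refl; sym; trans; cong; cong₂; subst; subst₂; module ≡-Reasoning)
import Relation.Binary.PropositionalEquality as ≡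
open import Relation.Nullary using (Dec; yes; no)
open import Relation.Nullary.Decidable using (_×-dec_)
import Relation.Unary as U

module _ {A B : Set} (f : A → B) where

  Unique-map⁺-on : ∀ {xs} → Unique xs
    → (∀ {x y} → x ∈ xs → y ∈ xs → f x ≡ f y → x ≡ y) → Unique (map f xs)
  Unique-map⁺-on {[]} [] _ = []
  Unique-map⁺-on {x ∷ xs} (x∉xs ∷ xs!) f-inj =
    All.tabulate fx∉ ∷ Unique-map⁺-on xs! (λ x∈ y∈ → f-inj (there x∈) (there y∈))
    where
    fx∉ : ∀ {b} → b ∈ map f xs → f x ≢ b
    fx∉ b∈ fx≡b with ∈-map⁻ f b∈
    ... | y , y∈ , refl = All.lookup x∉xs y∈ (f-inj (here refl) (there y∈) fx≡b)

  Unique-map⇒injective-on : ∀ {xs} → Unique (map f xs)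
    → ∀ {x y} → x ∈ xs → y ∈ xs → f x ≡ f y → x ≡ y
  Unique-map⇒injective-on (_ ∷ _) (here refl) (here refl) _ = refl
  Unique-map⇒injective-on (fz∉ ∷ _) (here refl) (there y∈) fz≡fy =
    ⊥-elim (All.lookup fz∉ (∈-map⁺ f y∈) fz≡fy)
  Unique-map⇒injective-on (fz∉ ∷ _) (there x∈) (here refl) fx≡fz =
    ⊥-elim (All.lookup fz∉ (∈-map⁺ f x∈) (sym fx≡fz))
  Unique-map⇒injective-on (_ ∷ fzs!) (there x∈) (there y∈) fx≡fy =
    Unique-map⇒injective-on fzs! x∈ y∈ fx≡fy

Unique-++⁻ : ∀ {A : Set} (xs : List A) {ys} → Unique (xs ++ ys) → Unique xs × Unique ys × Disjoint xs ys
Unique-++⁻ [] ys! = [] , ys! , λ ()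
Unique-++⁻ (x ∷ xs) (x∉ ∷ xs++ys!) with Unique-++⁻ xs xs++ys!
... | xs! , ys! , xs#ys = AllP.++⁻ˡ xs x∉ ∷ xs! , ys! , x∷xs#ys
  where
  x∷xs#ys : Disjoint (x ∷ xs) _
  x∷xs#ys (here refl , x∈ys) = All.lookup (AllP.++⁻ʳ xs x∉) x∈ys refl
  x∷xs#ys (there v∈xs , v∈ys) = xs#ys (v∈xs , v∈ys)

module _ {A B : Set} {P : A → Set} {Q : B → Set} (f : A → B) (g : B → A)
         (f-maps : ∀ {a} → P a → Q (f a)) (g-maps : ∀ {b} → Q b → P (g b))
         (g∘f≡id : ∀ {a} → P a → g (f a) ≡ a) (f∘g≡id : ∀ {b} → Q b → f (g b) ≡ b) where

  length-≡-of-inverses : ∀ {xs ys}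
    → Unique xs → (∀ a → a ∈ xs ⇔ P a)
    → Unique ys → (∀ b → b ∈ ys ⇔ Q b)
    → length xs ≡ length ys
  length-≡-of-inverses {xs} {ys} xs! xs⇔P ys! ys⇔Q =
    trans (sym (length-map f xs)) (↭-length (∼bag⇒↭ (unique∧set⇒bag fxs! ys! (mk⇔ to from))))
    where
    P-of : ∀ {a} → a ∈ xs → P a
    P-of {a} = Equivalence.to (xs⇔P a)

    fxs! : Unique (map f xs)
    fxs! = Unique-map⁺-on f xs! λ a∈ a′∈ fa≡fa′ →
      trans (sym (g∘f≡id (P-of a∈))) (trans (cong g fa≡fa′) (g∘f≡id (P-of a′∈)))

    to : ∀ {b} → b ∈ map f xs → b ∈ ys
    to b∈ with ∈-map⁻ f b∈
    ... | a , a∈ , refl = Equivalence.from (ys⇔Q (f a)) (f-maps (P-of a∈))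

    from : ∀ {b} → b ∈ ys → b ∈ map f xs
    from {b} b∈ = subst (_∈ map f xs) (f∘g≡id Qb) (∈-map⁺ f (Equivalence.from (xs⇔P (g b)) (g-maps Qb)))
      where
      Qb : Q b
      Qb = Equivalence.to (ys⇔Q b) b∈

strictlySorted-≡ : ∀ {xs ys : List ℤ} → Linked ℤ._<_ xs → Linked ℤ._<_ ys
  → (∀ {z} → z ∈ xs ⇔ z ∈ ys) → xs ≡ ys
strictlySorted-≡ xs↗ ys↗ xs⇔ys =
  ≋⇒≡ (↗↭↗⇒≋ ℤP.≤-totalOrder (Linked.map ℤP.<⇒≤ xs↗) (Linked.map ℤP.<⇒≤ ys↗)
              (↭⇒↭ₛ (∼bag⇒↭ (unique∧set⇒bag (unique xs↗) (unique ys↗) xs⇔ys))))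
  where
  unique : ∀ {zs} → Linked ℤ._<_ zs → Unique zs
  unique zs↗ = AllPairs.map ℤP.<⇒≢ (Linked⇒AllPairs ℤP.<-trans zs↗)

module _ {A : Set} where

  block : List (List A) → ℕ → List A
  block [] _ = []
  block (B ∷ _) zero = B
  block (_ ∷ xss) (suc i) = block xss i

  ∈-block⇒< : ∀ xss i {x} → x ∈ block xss i → i < length xss
  ∈-block⇒< (B ∷ xss) zero _ = s≤s z≤n
  ∈-block⇒< (B ∷ xss) (suc i) x∈ = s≤s (∈-block⇒< xss i x∈)

  block-applyUpTo : ∀ f k i → i < k → block (applyUpTo f k) i ≡ f i
  block-applyUpTo f (suc k) zero _ = refl
  block-applyUpTo f (suc k) (suc i) (s≤s i<k) = block-applyUpTo (f ∘ suc) k i i<k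

  block-ext : ∀ xss yss → length xss ≡ length yss
    → (∀ i → i < length xss → block xss i ≡ block yss i) → xss ≡ yss
  block-ext [] [] _ _ = refl
  block-ext (B ∷ xss) (C ∷ yss) |xss|≡|yss| B≡C = cong₂ _∷_ (B≡C 0 (s≤s z≤n))
    (block-ext xss yss (ℕP.suc-injective |xss|≡|yss|) (λ i i<k → B≡C (suc i) (s≤s i<k)))

  All-block : ∀ {P : List A → Set} {xss} → All P xss → ∀ i → i < length xss → P (block xss i)
  All-block (p ∷ _) zero _ = p
  All-block (_ ∷ ps) (suc i) (s≤s i<k) = All-block ps i i<k

  Linked-block : ∀ {R : Rel (List A) 0ℓ} {xss} → Linked R xss
    → ∀ i → suc i < length xss → R (block xss i) (block xss (suc i))
  Linked-block [-] zero (s≤s ())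
  Linked-block (r ∷ _) zero _ = r
  Linked-block (_ ∷ rs) (suc i) (s≤s i<k) = Linked-block rs i i<k

  Linked-applyUpTo : ∀ {R : Rel (List A) 0ℓ} f k
    → (∀ i → suc i < k → R (f i) (f (suc i))) → Linked R (applyUpTo f k)
  Linked-applyUpTo f zero _ = []
  Linked-applyUpTo f (suc zero) _ = [-]
  Linked-applyUpTo f (suc (suc k)) R-f =
    R-f 0 (s≤s (s≤s z≤n)) ∷ Linked-applyUpTo (f ∘ suc) (suc k) (λ i i<k → R-f (suc i) (s≤s i<k))

module _ {A B : Set} (f : A → B) where

  ∈-concatMap-map⁺ : ∀ xss i {x} → x ∈ block xss i → f x ∈ concatMap (map f) xss
  ∈-concatMap-map⁺ (C ∷ xss) zero x∈ = ∈-++⁺ˡ (∈-map⁺ f x∈)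
  ∈-concatMap-map⁺ (C ∷ xss) (suc i) x∈ = ∈-++⁺ʳ (map f C) (∈-concatMap-map⁺ xss i x∈)

  ∈-concatMap-map⁻ : ∀ xss {b} → b ∈ concatMap (map f) xss → ∃[ i ] ∃[ x ] x ∈ block xss i × b ≡ f x
  ∈-concatMap-map⁻ (C ∷ xss) b∈ with ∈-++⁻ (map f C) b∈
  ... | inj₁ b∈C with ∈-map⁻ f b∈C
  ...   | x , x∈ , b≡fx = 0 , x , x∈ , b≡fx
  ∈-concatMap-map⁻ (C ∷ xss) b∈ | inj₂ b∈xss with ∈-concatMap-map⁻ xss b∈xss
  ...   | i , x , x∈ , b≡fx = suc i , x , x∈ , b≡fx

  InjectiveOnBlocks : List (List A) → Set
  InjectiveOnBlocks xss = ∀ {i j x y} → x ∈ block xss i → y ∈ block xss j → f x ≡ f y → i ≡ j × x ≡ y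

  Unique-concatMap-map⁻ : ∀ xss → Unique (concatMap (map f) xss) → InjectiveOnBlocks xss
  Unique-concatMap-map⁻ (C ∷ xss) C++xss! {i} {j} x∈ y∈ fx≡fy with Unique-++⁻ (map f C) C++xss!
  Unique-concatMap-map⁻ (C ∷ xss) _ {zero} {zero} x∈ y∈ fx≡fy | C! , _ , _ =
    refl , Unique-map⇒injective-on f C! x∈ y∈ fx≡fy
  Unique-concatMap-map⁻ (C ∷ xss) _ {zero} {suc j} x∈ y∈ fx≡fy | _ , _ , C#xss =
    ⊥-elim (C#xss (∈-map⁺ f x∈ ,
                   subst (_∈ concatMap (map f) xss) (sym fx≡fy) (∈-concatMap-map⁺ xss j y∈)))
  Unique-concatMap-map⁻ (C ∷ xss) _ {suc i} {zero} x∈ y∈ fx≡fy | _ , _ , C#xss =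
    ⊥-elim (C#xss (∈-map⁺ f y∈ ,
                   subst (_∈ concatMap (map f) xss) fx≡fy (∈-concatMap-map⁺ xss i x∈)))
  Unique-concatMap-map⁻ (C ∷ xss) _ {suc i} {suc j} x∈ y∈ fx≡fy | _ , xss! , _
    with Unique-concatMap-map⁻ xss xss! x∈ y∈ fx≡fy
  ... | refl , x≡y = refl , x≡y

  Unique-concatMap-map⁺ : ∀ xss → All Unique xss → InjectiveOnBlocks xss → Unique (concatMap (map f) xss)
  Unique-concatMap-map⁺ [] _ _ = []
  Unique-concatMap-map⁺ (C ∷ xss) (C! ∷ xss!) f-inj =
    UniqueP.++⁺ (Unique-map⁺-on f C! λ x∈ y∈ fx≡fy → proj₂ (f-inj {0} {0} x∈ y∈ fx≡fy))
                (Unique-concatMap-map⁺ xss xss! λ x∈ y∈ fx≡fy → suc-injective (f-inj x∈ y∈ fx≡fy))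
                C#xss
    where
    suc-injective : ∀ {i j} {x y : A} → suc i ≡ suc j × x ≡ y → i ≡ j × x ≡ y
    suc-injective (refl , x≡y) = refl , x≡y
    C#xss : Disjoint (map f C) (concatMap (map f) xss)
    C#xss (b∈C , b∈xss) with ∈-map⁻ f b∈C | ∈-concatMap-map⁻ xss b∈xss
    ... | x , x∈ , refl | i , y , y∈ , fx≡fy with f-inj {0} {suc i} x∈ y∈ fx≡fy
    ...   | () , _

countIf : {P : Set} → Dec P → ℕ → ℕ
countIf (yes _) = suc
countIf (no _) n = n

countIf-cong : {P Q : Set} → P ⇔ Q → (P? : Dec P) (Q? : Dec Q) → ∀ n → countIf P? n ≡ countIf Q? n
countIf-cong _ (yes _) (yes _) _ = refl
countIf-cong _ (no _) (no _) _ = refl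
countIf-cong P⇔Q (yes p) (no ¬q) _ = ⊥-elim (¬q (Equivalence.to P⇔Q p))
countIf-cong P⇔Q (no ¬p) (yes q) _ = ⊥-elim (¬p (Equivalence.from P⇔Q q))

module _ {A : Set} {R : Rel A 0ℓ} (R? : Decidable R) where

  adjacentCount : A → List A → ℕ
  adjacentCount _ [] = 0
  adjacentCount x (y ∷ ys) = countIf (R? x y) (adjacentCount y ys)

  private
    adjacentCount-unique : {h : A → List A → ℕ} {k : (x y : A) → List A → Dec (R x y) → ℕ}
      → (∀ x → h x [] ≡ 0)
      → (∀ x y ys → h x (y ∷ ys) ≡ k x y ys (R? x y))
      → (∀ x y ys r → k x y ys (yes r) ≡ suc (h y ys))
      → (∀ x y ys r → k x y ys (no r) ≡ h y ys)
      → ∀ x y ys d → k x y ys d ≡ countIf d (adjacentCount y ys)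
    adjacentCount-unique {h} {k} h[] h∷ k-yes k-no = unfold-k
      where
      unfold-h : ∀ x ys → h x ys ≡ adjacentCount x ys
      unfold-k : ∀ x y ys d → k x y ys d ≡ countIf d (adjacentCount y ys)
      unfold-h x [] = h[] x
      unfold-h x (y ∷ ys) = trans (h∷ x y ys) (unfold-k x y ys (R? x y))
      unfold-k x y ys (yes r) = trans (k-yes x y ys r) (cong suc (unfold-h y ys))
      unfold-k x y ys (no r) = trans (k-no x y ys r) (unfold-h y ys)

  -- `countAdj` recurses through a `where`-bound helper and its `with`-function, which cannot
  -- be named. Unification instantiates h and k with them, provided they are applied to
  -- variables distinct from the helper's hidden parameters: hence the generalisations below.
  countAdj-∷ : ∀ x xs → countAdj R? (x ∷ xs) ≡ adjacentCount x xs
  countAdj-∷ x xs with adjacentCount-unique {h = _} {k = _}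
                         (λ _ → refl) (λ _ _ _ → refl) (λ _ _ _ _ → refl) (λ _ _ _ _ → refl)
  countAdj-∷ x [] | _ = refl
  countAdj-∷ x (y ∷ ys) | unfold with R? x y | y ∷ ys | unfold
  countAdj-∷ x (y ∷ []) | _ | yes _ | _ | _ = refl
  countAdj-∷ x (y ∷ []) | _ | no _ | _ | _ = refl
  countAdj-∷ x (y ∷ z ∷ zs) | _ | yes _ | _ | unfold′ with R? y z
  ... | d = cong suc (unfold′ y z zs d)
  countAdj-∷ x (y ∷ z ∷ zs) | _ | no _ | _ | unfold′ with R? y z
  ... | d = unfold′ y z zs d

module _ {A B : Set} {R : Rel (List A) 0ℓ} {S : Rel (List B) 0ℓ} (R? : Decidable R) (S? : Decidable S) where

  adjacentCount-block-cong : ∀ x xss y yss → length xss ≡ length yss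
    → (∀ i → i < length xss → R (block (x ∷ xss) i) (block xss i) ⇔ S (block (y ∷ yss) i) (block yss i))
    → adjacentCount R? x xss ≡ adjacentCount S? y yss
  adjacentCount-block-cong x [] y [] _ _ = refl
  adjacentCount-block-cong x (x′ ∷ xss) y (y′ ∷ yss) |xss|≡|yss| R⇔S =
    trans (countIf-cong (R⇔S 0 (s≤s z≤n)) (R? x x′) (S? y y′) _)
          (cong (countIf (S? y y′)) (adjacentCount-block-cong x′ xss y′ yss (ℕP.suc-injective |xss|≡|yss|)
                                                             (λ i i<k → R⇔S (suc i) (s≤s i<k))))

  countAdj-block-cong : ∀ xss yss → length xss ≡ length yss
    → (∀ i → suc i < length xss → R (block xss i) (block xss (suc i)) ⇔ S (block yss i) (block yss (suc i)))
    → countAdj R? xss ≡ countAdj S? yss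
  countAdj-block-cong [] [] _ _ = refl
  countAdj-block-cong (x ∷ xss) (y ∷ yss) |x∷xss|≡|y∷yss| R⇔S = begin
    countAdj R? (x ∷ xss)    ≡⟨ countAdj-∷ R? x xss ⟩
    adjacentCount R? x xss   ≡⟨ adjacentCount-block-cong x xss y yss (ℕP.suc-injective |x∷xss|≡|y∷yss|)
                                                         (λ i i<k → R⇔S i (s≤s i<k)) ⟩
    adjacentCount S? y yss   ≡⟨ countAdj-∷ S? y yss ⟨
    countAdj S? (y ∷ yss)    ∎
    where open ≡-Reasoning

countBelow : (ℕ → ℕ) → ℕ → ℕ → ℕ
countBelow f zero a = 0
countBelow f (suc k) a = countIf (f k <? a) (countBelow f k a)

StrictlyIncreasingBelow : ℕ → (ℕ → ℕ) → Set
StrictlyIncreasingBelow k f = ∀ {i j} → i < j → j < k → f i < f j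

steps⇒StrictlyIncreasingBelow : ∀ {k f} → (∀ i → suc i < k → f i < f (suc i)) → StrictlyIncreasingBelow k f
steps⇒StrictlyIncreasingBelow step {i} {suc j} i<1+j 1+j<k with ℕP.m≤n⇒m<n∨m≡n (ℕP.≤-pred i<1+j)
... | inj₁ i<j = ℕP.<-trans (steps⇒StrictlyIncreasingBelow step i<j (ℕP.<⇒≤ 1+j<k)) (step j 1+j<k)
... | inj₂ refl = step i 1+j<k

countBelow-≤ : ∀ f k a → countBelow f k a ≤ k
countBelow-≤ f zero a = z≤n
countBelow-≤ f (suc k) a with f k <? a
... | yes _ = s≤s (countBelow-≤ f k a)
... | no _ = ℕP.m≤n⇒m≤1+n (countBelow-≤ f k a)

countBelow-all : ∀ f k a → (∀ {i} → i < k → f i < a) → countBelow f k a ≡ k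
countBelow-all f zero a _ = refl
countBelow-all f (suc k) a f<a with f k <? a
... | yes _ = cong suc (countBelow-all f k a (f<a ∘ ℕP.m<n⇒m<1+n))
... | no fk≮a = ⊥-elim (fk≮a (f<a ℕP.≤-refl))

countBelow-cong : ∀ {f g} k a → (∀ {i} → i < k → f i ≡ g i) → countBelow f k a ≡ countBelow g k a
countBelow-cong zero a _ = refl
countBelow-cong {f} {g} (suc k) a f≡g
  rewrite f≡g {k} ℕP.≤-refl | countBelow-cong {f} {g} k a (f≡g ∘ ℕP.m<n⇒m<1+n) = refl

<-countBelow⇔ : ∀ {f k} a → StrictlyIncreasingBelow k f → ∀ i → i < countBelow f k a ⇔ (i < k × f i < a)
<-countBelow⇔ {f} {zero} a _ i = mk⇔ (λ ()) (λ ())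
<-countBelow⇔ {f} {suc k} a f↗ i with f k <? a
... | yes fk<a rewrite countBelow-all f k a (λ i<k → ℕP.<-trans (f↗ i<k ℕP.≤-refl) fk<a) =
  mk⇔ (λ i≤k → i≤k , fi<a (ℕP.≤-pred i≤k)) proj₁
  where
  fi<a : i ≤ k → f i < a
  fi<a i≤k with ℕP.m≤n⇒m<n∨m≡n i≤k
  ... | inj₁ i<k = ℕP.<-trans (f↗ i<k ℕP.≤-refl) fk<a
  ... | inj₂ refl = fk<a
... | no fk≮a = mk⇔ to from
  where
  IH : i < countBelow f k a ⇔ (i < k × f i < a)
  IH = <-countBelow⇔ a (λ i<j j<k → f↗ i<j (ℕP.m<n⇒m<1+n j<k)) i
  to : i < countBelow f k a → i < suc k × f i < a
  to i<c with Equivalence.to IH i<c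
  ... | i<k , fi<a = ℕP.m<n⇒m<1+n i<k , fi<a
  from : i < suc k × f i < a → i < countBelow f k a
  from (i≤k , fi<a) with ℕP.m≤n⇒m<n∨m≡n (ℕP.≤-pred i≤k)
  ... | inj₁ i<k = Equivalence.from IH (i<k , fi<a)
  ... | inj₂ refl = ⊥-elim (fk≮a fi<a)

module _ {a ℓ₁ ℓ₂} {O : TotalPreorder a ℓ₁ ℓ₂} (minOp : MinOperator O) where
  open TotalPreorder O using (_≈_; module Eq) renaming (_≲_ to _≤ₒ_; refl to ≤ₒ-refl; trans to ≤ₒ-trans)
  open MinOperator minOp
  open MinOp minOp using (⊓-sel; x⊓y≤x; x⊓y≤y)

  foldl-⊓-sel : ∀ x ys → Any (foldl _⊓_ x ys ≈_) (x ∷ ys)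
  foldl-⊓-sel x [] = here Eq.refl
  foldl-⊓-sel x (y ∷ ys) with foldl-⊓-sel (x ⊓ y) ys | ⊓-sel x y
  ... | here r≈x⊓y | inj₁ x⊓y≈x = here (Eq.trans r≈x⊓y x⊓y≈x)
  ... | here r≈x⊓y | inj₂ x⊓y≈y = there (here (Eq.trans r≈x⊓y x⊓y≈y))
  ... | there r∈ys | _ = there (there r∈ys)

  foldl-⊓-≤ : ∀ x ys → All (foldl _⊓_ x ys ≤ₒ_) (x ∷ ys)
  foldl-⊓-≤ x [] = ≤ₒ-refl ∷ []
  foldl-⊓-≤ x (y ∷ ys) with foldl-⊓-≤ (x ⊓ y) ys
  ... | r≤x⊓y ∷ r≤ys = ≤ₒ-trans r≤x⊓y (x⊓y≤x x y) ∷ ≤ₒ-trans r≤x⊓y (x⊓y≤y x y) ∷ r≤ys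

private
  foldl-unique : {A B : Set} {h : B → List A → B} (_∙_ : B → A → B)
    → (∀ b → h b [] ≡ b) → (∀ b y ys → h b (y ∷ ys) ≡ h (b ∙ y) ys)
    → ∀ b ys → h b ys ≡ foldl _∙_ b ys
  foldl-unique _∙_ h[] h∷ b [] = h[] b
  foldl-unique {h = h} _∙_ h[] h∷ b (y ∷ ys) =
    trans (h∷ b y ys) (foldl-unique {h = h} _∙_ h[] h∷ (b ∙ y) ys)

  ⊔-minOperatorℕ : MinOperator (flipOrder ℕP.≤-totalPreorder)
  ⊔-minOperatorℕ = MaxOp⇒MinOp ℕP.⊔-operator

  ⊔-minOperatorℤ : MinOperator (flipOrder ℤP.≤-totalPreorder)
  ⊔-minOperatorℤ = MaxOp⇒MinOp ℤP.⊔-operator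

-- The folds of Defs run through unnamed local helpers, recovered as for `countAdj-∷`.
minAbs-∷ : ∀ x xs → minAbs (x ∷ xs) ≡ foldl ℕ._⊓_ ∣ x ∣ (map ∣_∣ xs)
minAbs-∷ x xs with foldl-unique {h = _} (λ m y → m ℕ.⊓ ∣ y ∣) (λ _ → refl) (λ _ _ _ → refl)
minAbs-∷ x [] | _ = refl
minAbs-∷ x (y ∷ ys) | unfold with ∣ x ∣ ℕ.⊓ ∣ y ∣ | y ∷ ys | unfold
... | m | _ | unfold′ = trans (unfold′ m ys) (sym (foldl-map ℕ._⊓_ ∣_∣ m ys))

maxAbs-∷ : ∀ x xs → maxAbs (x ∷ xs) ≡ foldl ℕ._⊔_ ∣ x ∣ (map ∣_∣ xs)
maxAbs-∷ x xs with foldl-unique {h = _} (λ m y → m ℕ.⊔ ∣ y ∣) (λ _ → refl) (λ _ _ _ → refl)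
maxAbs-∷ x [] | _ = refl
maxAbs-∷ x (y ∷ ys) | unfold with ∣ x ∣ ℕ.⊔ ∣ y ∣ | y ∷ ys | unfold
... | m | _ | unfold′ = trans (unfold′ m ys) (sym (foldl-map ℕ._⊔_ ∣_∣ m ys))

minℤ-∷ : ∀ x xs → minℤ (x ∷ xs) ≡ foldl ℤ._⊓_ x xs
minℤ-∷ x xs with foldl-unique {h = _} ℤ._⊓_ (λ _ → refl) (λ _ _ _ → refl)
minℤ-∷ x [] | _ = refl
minℤ-∷ x (y ∷ ys) | unfold with x ℤ.⊓ y | y ∷ ys | unfold
... | m | _ | unfold′ = unfold′ m ys

maxℤ-∷ : ∀ x xs → maxℤ (x ∷ xs) ≡ foldl ℤ._⊔_ x xs
maxℤ-∷ x xs with foldl-unique {h = _} ℤ._⊔_ (λ _ → refl) (λ _ _ _ → refl)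
maxℤ-∷ x [] | _ = refl
maxℤ-∷ x (y ∷ ys) | unfold with x ℤ.⊔ y | y ∷ ys | unfold
... | m | _ | unfold′ = unfold′ m ys

minAbs-∈ : ∀ x xs → minAbs (x ∷ xs) ∈ map ∣_∣ (x ∷ xs)
minAbs-∈ x xs rewrite minAbs-∷ x xs = foldl-⊓-sel ℕP.⊓-operator ∣ x ∣ (map ∣_∣ xs)

minAbs-≤ : ∀ {B b} → b ∈ B → minAbs B ≤ ∣ b ∣
minAbs-≤ {x ∷ xs} b∈B rewrite minAbs-∷ x xs =
  All.lookup (foldl-⊓-≤ ℕP.⊓-operator ∣ x ∣ (map ∣_∣ xs)) (∈-map⁺ ∣_∣ b∈B)

minAbs-≡ : ∀ {B a} → a ∈ B → (∀ {b} → b ∈ B → ∣ a ∣ ≤ ∣ b ∣) → minAbs B ≡ ∣ a ∣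
minAbs-≡ {x ∷ xs} {a} a∈B a-least with ∈-map⁻ ∣_∣ (minAbs-∈ x xs)
... | b , b∈B , min≡∣b∣ =
  ℕP.≤-antisym (minAbs-≤ a∈B) (subst (∣ a ∣ ≤_) (sym min≡∣b∣) (a-least b∈B))

maxAbs-∈ : ∀ x xs → maxAbs (x ∷ xs) ∈ map ∣_∣ (x ∷ xs)
maxAbs-∈ x xs rewrite maxAbs-∷ x xs = foldl-⊓-sel ⊔-minOperatorℕ ∣ x ∣ (map ∣_∣ xs)

≤-maxAbs : ∀ {B b} → b ∈ B → ∣ b ∣ ≤ maxAbs B
≤-maxAbs {x ∷ xs} b∈B rewrite maxAbs-∷ x xs =
  All.lookup (foldl-⊓-≤ ⊔-minOperatorℕ ∣ x ∣ (map ∣_∣ xs)) (∈-map⁺ ∣_∣ b∈B)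

maxAbs-<⁺ : ∀ {B m} → 0 < m → (∀ {b} → b ∈ B → ∣ b ∣ < m) → maxAbs B < m
maxAbs-<⁺ {[]} 0<m _ = 0<m
maxAbs-<⁺ {x ∷ xs} _ B<m with ∈-map⁻ ∣_∣ (maxAbs-∈ x xs)
... | b , b∈B , max≡∣b∣ = subst (_< _) (sym max≡∣b∣) (B<m b∈B)

minℤ-∈ : ∀ x xs → minℤ (x ∷ xs) ∈ x ∷ xs
minℤ-∈ x xs rewrite minℤ-∷ x xs = foldl-⊓-sel ℤP.⊓-operator x xs

minℤ-≤ : ∀ {B b} → b ∈ B → minℤ B ℤ.≤ b
minℤ-≤ {x ∷ xs} b∈B rewrite minℤ-∷ x xs = All.lookup (foldl-⊓-≤ ℤP.⊓-operator x xs) b∈B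

maxℤ-∈ : ∀ x xs → maxℤ (x ∷ xs) ∈ x ∷ xs
maxℤ-∈ x xs rewrite maxℤ-∷ x xs = foldl-⊓-sel ⊔-minOperatorℤ x xs

≤-maxℤ : ∀ {B b} → b ∈ B → b ℤ.≤ maxℤ B
≤-maxℤ {x ∷ xs} b∈B rewrite maxℤ-∷ x xs = All.lookup (foldl-⊓-≤ ⊔-minOperatorℤ x xs) b∈B

NormalMergeRel⇒< : ∀ {B C b c} → NormalMergeRel B C → b ∈ B → c ∈ C → b ℤ.< c
NormalMergeRel⇒< B<C b∈B c∈C = ℤP.≤-<-trans (≤-maxℤ b∈B) (ℤP.<-≤-trans B<C (minℤ-≤ c∈C))

<⇒NormalMergeRel : ∀ {B C b c} → b ∈ B → c ∈ C
  → (∀ {b c} → b ∈ B → c ∈ C → b ℤ.< c) → NormalMergeRel B C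
<⇒NormalMergeRel {x ∷ xs} {y ∷ ys} _ _ B<C = B<C (maxℤ-∈ x xs) (minℤ-∈ y ys)

MinAbsPositive⇒ : ∀ {B} → MinAbsPositive B → + minAbs B ∈ B × 0 < minAbs B
MinAbsPositive⇒ minPos with find minPos
... | + m , m∈B , ℤ.+<+ 0<m , m-least rewrite minAbs-≡ m∈B (All.lookup m-least) = m∈B , 0<m

MinAbsPositive⁺ : ∀ {B m} → 0 < m → + m ∈ B → (∀ {b} → b ∈ B → m ≤ ∣ b ∣) → MinAbsPositive B
MinAbsPositive⁺ 0<m m∈B m-least = lose m∈B (ℤ.+<+ 0<m , All.tabulate m-least)

-- Partitions in standard form

oneTo : ℕ → List ℕ
oneTo n = map suc (upTo n)

∈-oneTo⁺ : ∀ {m n} → m < n → suc m ∈ oneTo n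
∈-oneTo⁺ m<n = ∈-map⁺ suc (∈-upTo⁺ m<n)

∈-oneTo⁻ : ∀ {a n} → a ∈ oneTo n → ∃[ m ] a ≡ suc m × m < n
∈-oneTo⁻ a∈ with ∈-map⁻ suc a∈
... | m , m∈ , refl = m , refl , ∈-upTo⁻ m∈

oneTo-unique : ∀ n → Unique (oneTo n)
oneTo-unique n = UniqueP.map⁺ ℕP.suc-injective (UniqueP.upTo⁺ n)

signedRange : ℕ → List ℤ
signedRange n = applyDownFrom -[1+_] n ++ applyUpTo (+_ ∘ suc) n

∈-signedRange⁺ : ∀ {n} x → ∣ x ∣ ∈ oneTo n → x ∈ signedRange n
∈-signedRange⁺ (+ zero) 0∈ with ∈-oneTo⁻ 0∈
... | _ , () , _
∈-signedRange⁺ {n} (+ suc m) ∣x∣∈ with ∈-oneTo⁻ ∣x∣∈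
... | _ , refl , m<n = ∈-++⁺ʳ (applyDownFrom -[1+_] n) (∈-applyUpTo⁺ (+_ ∘ suc) m<n)
∈-signedRange⁺ -[1+ m ] ∣x∣∈ with ∈-oneTo⁻ ∣x∣∈
... | _ , refl , m<n = ∈-++⁺ˡ (∈-applyDownFrom⁺ -[1+_] m<n)

∈-signedRange⁻ : ∀ {n x} → x ∈ signedRange n → ∣ x ∣ ∈ oneTo n
∈-signedRange⁻ {n} x∈ with ∈-++⁻ (applyDownFrom -[1+_] n) x∈
... | inj₁ x∈negatives with ∈-applyDownFrom⁻ -[1+_] x∈negatives
...   | _ , m<n , refl = ∈-oneTo⁺ m<n
∈-signedRange⁻ x∈ | inj₂ x∈positives with ∈-applyUpTo⁻ (+_ ∘ suc) x∈positives
...   | _ , m<n , refl = ∈-oneTo⁺ m<n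

signedRange-sorted : ∀ n → AllPairs ℤ._<_ (signedRange n)
signedRange-sorted n = AllPairsP.++⁺
  (AllPairsP.applyDownFrom⁺₁ -[1+_] n (λ j<i _ → ℤ.-<- j<i))
  (AllPairsP.applyUpTo⁺₁ (+_ ∘ suc) n (λ i<j _ → ℤ.+<+ (s≤s i<j)))
  (All.tabulate λ x∈ → All.tabulate λ y∈ → negative<positive x∈ y∈)
  where
  negative<positive : ∀ {x y} → x ∈ applyDownFrom -[1+_] n → y ∈ applyUpTo (+_ ∘ suc) n → x ℤ.< y
  negative<positive x∈ y∈ with ∈-applyDownFrom⁻ -[1+_] x∈ | ∈-applyUpTo⁻ (+_ ∘ suc) y∈
  ... | _ , _ , refl | _ , _ , refl = ℤ.-<+

absValues : SPart → List ℕ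
absValues = concatMap (map ∣_∣)

mins : SPart → ℕ → ℕ
mins π i = minAbs (block π i)

below : SPart → ℕ → ℕ
below π = countBelow (mins π) (length π)

below-≤ : ∀ π a → below π a ≤ length π
below-≤ π = countBelow-≤ (mins π) (length π)

module Standard {n π} (std : StdForm n π) where

  k : ℕ
  k = length π

  private
    blocks-sorted : All (λ B → NonEmpty B × Linked ℤ._<_ B) π
    blocks-sorted = proj₁ std
    abs-perm : absValues π ↭ oneTo n
    abs-perm = proj₁ (proj₂ std)
    blocks-minPos : All MinAbsPositive π
    blocks-minPos = proj₁ (proj₂ (proj₂ std))
    mins-linked : Linked (λ B C → minAbs B < minAbs C) π
    mins-linked = proj₂ (proj₂ (proj₂ std))

  block-sorted : ∀ i → i < k → Linked ℤ._<_ (block π i)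
  block-sorted i i<k = proj₂ (All-block blocks-sorted i i<k)

  ∈-signedRange : ∀ {i x} → x ∈ block π i → x ∈ signedRange n
  ∈-signedRange {i} {x} x∈ = ∈-signedRange⁺ x (∈-resp-↭ abs-perm (∈-concatMap-map⁺ ∣_∣ π i x∈))

  abs-injective : InjectiveOnBlocks ∣_∣ π
  abs-injective = Unique-concatMap-map⁻ ∣_∣ π
    (PermutationSetoid.Unique-resp-↭ (≡.setoid ℕ) (↭⇒↭ₛ (↭-sym abs-perm)) (oneTo-unique n))

  abs-cover : ∀ {a} → a ∈ oneTo n → ∃[ i ] ∃[ x ] x ∈ block π i × a ≡ ∣ x ∣
  abs-cover a∈ = ∈-concatMap-map⁻ ∣_∣ π (∈-resp-↭ (↭-sym abs-perm) a∈)

  +mins-∈ : ∀ i → i < k → + mins π i ∈ block π i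
  +mins-∈ i i<k = proj₁ (MinAbsPositive⇒ (All-block blocks-minPos i i<k))

  mins-positive : ∀ i → i < k → 0 < mins π i
  mins-positive i i<k = proj₂ (MinAbsPositive⇒ (All-block blocks-minPos i i<k))

  mins-↗ : StrictlyIncreasingBelow k (mins π)
  mins-↗ = steps⇒StrictlyIncreasingBelow (Linked-block mins-linked)

  <-below⇔ : ∀ a i → i < below π a ⇔ (i < k × mins π i < a)
  <-below⇔ a = <-countBelow⇔ a mins-↗

  mins-<-negative : ∀ {i m} → -[1+ m ] ∈ block π i → mins π i < suc m
  mins-<-negative {i} -m∈ with ℕP.m≤n⇒m<n∨m≡n (minAbs-≤ -m∈)
  ... | inj₁ mins<m = mins<m
  ... | inj₂ mins≡m with abs-injective (+mins-∈ i (∈-block⇒< π i -m∈)) -m∈ mins≡m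
  ...   | _ , ()

  <-below-negative : ∀ {i m} → -[1+ m ] ∈ block π i → i < below π (suc m)
  <-below-negative {i} -m∈ = Equivalence.from (<-below⇔ _ i) (∈-block⇒< π i -m∈ , mins-<-negative -m∈)

StdForm-ext : ∀ {n π π′} → StdForm n π → StdForm n π′ → length π ≡ length π′
  → (∀ i → i < length π → ∀ {x} → x ∈ block π i ⇔ x ∈ block π′ i) → π ≡ π′
StdForm-ext {π = π} {π′} std std′ |π|≡|π′| same-blocks = block-ext π π′ |π|≡|π′| λ i i<k →
  strictlySorted-≡ (Standard.block-sorted std i i<k) (Standard.block-sorted std′ i (subst (i <_) |π|≡|π′| i<k))
                   (same-blocks i i<k)

module Assemble (n k : ℕ) (P : ℕ → ℤ → Set) (P? : ∀ i → U.Decidable (P i)) where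

  row : ℕ → Block
  row i = filter (P? i) (signedRange n)

  assembled : SPart
  assembled = applyUpTo row k

  length-assembled : length assembled ≡ k
  length-assembled = length-applyUpTo row k

  ∈-assembled⁻ : ∀ {i x} → x ∈ block assembled i → i < k × P i x
  ∈-assembled⁻ {i} x∈ with subst (i <_) length-assembled (∈-block⇒< assembled i x∈)
  ... | i<k rewrite block-applyUpTo row k i i<k = i<k , proj₂ (∈-filter⁻ (P? i) {xs = signedRange n} x∈)

  record Conditions : Set where
    field
      least : ℕ → ℕ
      least-positive : ∀ {i} → i < k → 0 < least i
      P-least : ∀ {i} → i < k → P i (+ least i)
      least-≤ : ∀ {i x} → i < k → P i x → least i ≤ ∣ x ∣
      least-↗ : ∀ i → suc i < k → least i < least (suc i)
      P-signedRange : ∀ {i x} → i < k → P i x → x ∈ signedRange n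
      P-injective : ∀ {i j x y} → i < k → j < k → P i x → P j y → ∣ x ∣ ≡ ∣ y ∣ → i ≡ j × x ≡ y
      P-cover : ∀ {a} → a ∈ oneTo n → ∃[ i ] ∃[ x ] i < k × P i x × a ≡ ∣ x ∣

  module _ (conditions : Conditions) where
    open Conditions conditions

    ∈-row⇔ : ∀ {i x} → i < k → x ∈ row i ⇔ P i x
    ∈-row⇔ {i} i<k = mk⇔ (proj₂ ∘ ∈-filter⁻ (P? i) {xs = signedRange n})
                         (λ Pix → ∈-filter⁺ (P? i) (P-signedRange i<k Pix) Pix)

    ∈-assembled⇔ : ∀ {i x} → i < k → x ∈ block assembled i ⇔ P i x
    ∈-assembled⇔ {i} i<k rewrite block-applyUpTo row k i i<k = ∈-row⇔ i<k

    +least-∈-row : ∀ {i} → i < k → + least i ∈ row i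
    +least-∈-row i<k = Equivalence.from (∈-row⇔ i<k) (P-least i<k)

    least-≤-row : ∀ {i x} → i < k → x ∈ row i → least i ≤ ∣ x ∣
    least-≤-row i<k = least-≤ i<k ∘ Equivalence.to (∈-row⇔ i<k)

    minAbs-row : ∀ {i} → i < k → minAbs (row i) ≡ least i
    minAbs-row i<k = minAbs-≡ (+least-∈-row i<k) (least-≤-row i<k)

    mins-assembled : ∀ i → i < k → mins assembled i ≡ least i
    mins-assembled i i<k rewrite block-applyUpTo row k i i<k = minAbs-row i<k

    row-sorted : ∀ i → Linked ℤ._<_ (row i)
    row-sorted i = AllPairs⇒Linked (AllPairsP.filter⁺ (P? i) (signedRange-sorted n))

    abs-injective-assembled : InjectiveOnBlocks ∣_∣ assembled
    abs-injective-assembled x∈ y∈ ∣x∣≡∣y∣ with ∈-assembled⁻ x∈ | ∈-assembled⁻ y∈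
    ... | i<k , Pix | j<k , Pjy = P-injective i<k j<k Pix Pjy ∣x∣≡∣y∣

    absValues-assembled↭oneTo : absValues assembled ↭ oneTo n
    absValues-assembled↭oneTo = ∼bag⇒↭ (unique∧set⇒bag
      (Unique-concatMap-map⁺ ∣_∣ assembled rows-unique abs-injective-assembled) (oneTo-unique n) (mk⇔ to from))
      where
      rows-unique : All Unique assembled
      rows-unique = AllP.applyUpTo⁺₂ row k λ i →
        AllPairs.map ℤP.<⇒≢ (Linked⇒AllPairs ℤP.<-trans (row-sorted i))
      to : ∀ {a} → a ∈ absValues assembled → a ∈ oneTo n
      to a∈ with ∈-concatMap-map⁻ ∣_∣ assembled a∈
      ... | i , x , x∈ , refl with ∈-assembled⁻ x∈
      ...   | i<k , Pix = ∈-signedRange⁻ (P-signedRange i<k Pix)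
      from : ∀ {a} → a ∈ oneTo n → a ∈ absValues assembled
      from a∈ with P-cover a∈
      ... | i , x , i<k , Pix , refl =
        ∈-concatMap-map⁺ ∣_∣ assembled i (Equivalence.from (∈-assembled⇔ i<k) Pix)

    assembled-std : StdForm n assembled
    assembled-std = blocks-sorted , absValues-assembled↭oneTo , blocks-minPos , mins-linked
      where
      nonEmpty : ∀ {x : ℤ} {B} → x ∈ B → NonEmpty B
      nonEmpty (here _) = _
      nonEmpty (there _) = _

      blocks-sorted : All (λ B → NonEmpty B × Linked ℤ._<_ B) assembled
      blocks-sorted = AllP.applyUpTo⁺₁ row k λ {i} i<k → nonEmpty (+least-∈-row i<k) , row-sorted i

      blocks-minPos : All MinAbsPositive assembled
      blocks-minPos = AllP.applyUpTo⁺₁ row k λ i<k →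
        MinAbsPositive⁺ (least-positive i<k) (+least-∈-row i<k) (least-≤-row i<k)

      mins-linked : Linked (λ B C → minAbs B < minAbs C) assembled
      mins-linked = Linked-applyUpTo row k λ i 1+i<k →
        subst₂ _<_ (sym (minAbs-row (ℕP.<⇒≤ 1+i<k))) (sym (minAbs-row 1+i<k)) (least-↗ i 1+i<k)

-- Rotating negative entries

-- Block j of the rotation keeps the positive entries of block j and receives each -(m+1) from
-- block σ c j, where c = below π (m+1) counts the blocks that can contain -(m+1).
Rotated : (ℕ → ℕ → ℕ) → SPart → ℕ → ℤ → Set
Rotated σ π j (+ m) = + m ∈ block π j
Rotated σ π j -[1+ m ] = j < below π (suc m) × -[1+ m ] ∈ block π (σ (below π (suc m)) j)

Rotated? : ∀ σ π j → U.Decidable (Rotated σ π j)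
Rotated? σ π j (+ m) = + m ∈? block π j
Rotated? σ π j -[1+ m ] = j <? below π (suc m) ×-dec -[1+ m ] ∈? block π (σ (below π (suc m)) j)

rotate : ℕ → (ℕ → ℕ → ℕ) → SPart → SPart
rotate n σ π = Assemble.assembled n (length π) (Rotated σ π) (Rotated? σ π)

InverseOn : (σ τ : ℕ → ℕ → ℕ) → Set
InverseOn σ τ = ∀ {c j} → j < c → σ c j < c × τ c (σ c j) ≡ j

module Rotation {n π} (std : StdForm n π) {σ τ} (τσ≡id : InverseOn σ τ) (στ≡id : InverseOn τ σ) where
  open Standard std
  open Assemble n k (Rotated σ π) (Rotated? σ π)
    using (Conditions; assembled-std; ∈-assembled⇔; mins-assembled; length-assembled)

  private
    least-≤ : ∀ {i x} → i < k → Rotated σ π i x → mins π i ≤ ∣ x ∣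
    least-≤ {x = + _} _ x∈ = minAbs-≤ x∈
    least-≤ {i} { -[1+ m ]} _ (i<c , _) = ℕP.<⇒≤ (proj₂ (Equivalence.to (<-below⇔ (suc m) i) i<c))

    P-signedRange : ∀ {i x} → i < k → Rotated σ π i x → x ∈ signedRange n
    P-signedRange {x = + _} _ x∈ = ∈-signedRange x∈
    P-signedRange {x = -[1+ _ ]} _ (_ , x∈) = ∈-signedRange x∈

    P-injective : ∀ {i j x y} → i < k → j < k → Rotated σ π i x → Rotated σ π j y
      → ∣ x ∣ ≡ ∣ y ∣ → i ≡ j × x ≡ y
    P-injective {x = + _} {+ _} _ _ x∈ y∈ ∣x∣≡∣y∣ = abs-injective x∈ y∈ ∣x∣≡∣y∣
    P-injective {x = + _} { -[1+ _ ]} _ _ x∈ (_ , y∈) ∣x∣≡∣y∣ with abs-injective x∈ y∈ ∣x∣≡∣y∣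
    ... | _ , ()
    P-injective {x = -[1+ _ ]} {+ _} _ _ (_ , x∈) y∈ ∣x∣≡∣y∣ with abs-injective x∈ y∈ ∣x∣≡∣y∣
    ... | _ , ()
    P-injective {i} {j} { -[1+ m ]} { -[1+ _ ]} _ _ (i<c , x∈) (j<c , y∈) ∣x∣≡∣y∣
      with abs-injective x∈ y∈ ∣x∣≡∣y∣
    ... | σi≡σj , refl = (begin
      i             ≡⟨ proj₂ (τσ≡id i<c) ⟨
      τ c (σ c i)   ≡⟨ cong (τ c) σi≡σj ⟩
      τ c (σ c j)   ≡⟨ proj₂ (τσ≡id j<c) ⟩
      j             ∎) , refl
      where
      open ≡-Reasoning
      c = below π (suc m)

    P-cover : ∀ {a} → a ∈ oneTo n → ∃[ j ] ∃[ x ] j < k × Rotated σ π j x × a ≡ ∣ x ∣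
    P-cover a∈ with abs-cover a∈
    ... | i , + m , x∈ , a≡∣x∣ = i , + m , ∈-block⇒< π i x∈ , x∈ , a≡∣x∣
    ... | i , -[1+ m ] , x∈ , a≡∣x∣ with στ≡id (<-below-negative x∈)
    ...   | τi<c , στi≡i =
      τ c i , -[1+ m ] , ℕP.<-≤-trans τi<c (below-≤ π (suc m)) ,
      (τi<c , subst (λ l → -[1+ m ] ∈ block π l) (sym στi≡i) x∈) , a≡∣x∣
      where
      c = below π (suc m)

    conditions : Conditions
    conditions = record
      { least = mins π
      ; least-positive = mins-positive _
      ; P-least = +mins-∈ _
      ; least-≤ = least-≤
      ; least-↗ = λ i → mins-↗ (ℕP.n<1+n i)
      ; P-signedRange = P-signedRange
      ; P-injective = P-injective
      ; P-cover = P-cover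
      }

  rotate-std : StdForm n (rotate n σ π)
  rotate-std = assembled-std conditions

  ∈-rotate⇔ : ∀ {i x} → i < k → x ∈ block (rotate n σ π) i ⇔ Rotated σ π i x
  ∈-rotate⇔ = ∈-assembled⇔ conditions

  length-rotate : length (rotate n σ π) ≡ k
  length-rotate = length-assembled

  below-rotate : ∀ a → below (rotate n σ π) a ≡ below π a
  below-rotate a rewrite length-rotate = countBelow-cong k a (mins-assembled conditions _)

rotate-inverse : ∀ {n π σ τ} → StdForm n π → InverseOn σ τ → InverseOn τ σ
  → rotate n τ (rotate n σ π) ≡ π
rotate-inverse {n} {π} {σ} {τ} std τσ≡id στ≡id =
  StdForm-ext R′.rotate-std std (trans R′.length-rotate R.length-rotate) same-blocks
  where
  module R = Rotation std τσ≡id στ≡id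
  module R′ = Rotation R.rotate-std στ≡id τσ≡id
  open Standard std

  π′ = rotate n σ π

  unrotate : ∀ i → i < k → ∀ x → Rotated τ π′ i x ⇔ x ∈ block π i
  unrotate i i<k (+ m) = R.∈-rotate⇔ i<k
  unrotate i i<k -[1+ m ] rewrite R.below-rotate (suc m) = mk⇔ to from
    where
    c = below π (suc m)
    to : i < c × -[1+ m ] ∈ block π′ (τ c i) → -[1+ m ] ∈ block π i
    to (i<c , x∈) with στ≡id i<c
    ... | τi<c , στi≡i with Equivalence.to (R.∈-rotate⇔ (ℕP.<-≤-trans τi<c (below-≤ π (suc m)))) x∈
    ...   | _ , x∈π = subst (λ l → -[1+ m ] ∈ block π l) στi≡i x∈π
    from : -[1+ m ] ∈ block π i → i < c × -[1+ m ] ∈ block π′ (τ c i)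
    from x∈ with στ≡id (<-below-negative x∈)
    ... | τi<c , στi≡i = <-below-negative x∈ ,
      Equivalence.from (R.∈-rotate⇔ (ℕP.<-≤-trans τi<c (below-≤ π (suc m))))
                       (τi<c , subst (λ l → -[1+ m ] ∈ block π l) (sym στi≡i) x∈)

  same-blocks : ∀ i → i < length (rotate n τ π′)
    → ∀ {x} → x ∈ block (rotate n τ π′) i ⇔ x ∈ block π i
  same-blocks i i<k″ {x} =
    unrotate i (subst (i <_) (trans R′.length-rotate R.length-rotate) i<k″) x
      ⇔-∘ R′.∈-rotate⇔ (subst (i <_) R′.length-rotate i<k″)

cyclePred : ℕ → ℕ → ℕ
cyclePred c zero = c ∸ 1
cyclePred c (suc j) = j

cycleSucc : ℕ → ℕ → ℕ
cycleSucc c j with suc j <? c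
... | yes _ = suc j
... | no _ = 0

cycleSucc∘cyclePred : InverseOn cyclePred cycleSucc
cycleSucc∘cyclePred {suc c} {zero} _ with suc c <? suc c
... | yes c<c = ⊥-elim (ℕP.<-irrefl refl c<c)
... | no _ = ℕP.≤-refl , refl
cycleSucc∘cyclePred {c} {suc j} 1+j<c with suc j <? c
... | yes _ = ℕP.<⇒≤ 1+j<c , refl
... | no 1+j≮c = ⊥-elim (1+j≮c 1+j<c)

cyclePred∘cycleSucc : InverseOn cycleSucc cyclePred
cyclePred∘cycleSucc {c} {j} j<c with suc j <? c
... | yes 1+j<c = 1+j<c , refl
... | no 1+j≮c = ℕP.≤-<-trans z≤n j<c , cong (_∸ 1) (ℕP.≤-antisym (ℕP.≮⇒≥ 1+j≮c) j<c)

shiftNegatives unshiftNegatives : ℕ → SPart → SPart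
shiftNegatives n = rotate n cyclePred
unshiftNegatives n = rotate n cycleSucc

module _ {n π} (std : StdForm n π) where
  open Standard std
  open Rotation std cycleSucc∘cyclePred cyclePred∘cycleSucc

  shiftNegatives-std : StdForm n (shiftNegatives n π)
  shiftNegatives-std = rotate-std

  unshiftNegatives-std : StdForm n (unshiftNegatives n π)
  unshiftNegatives-std = Rotation.rotate-std std cyclePred∘cycleSucc cycleSucc∘cyclePred

  unshift∘shift≡id : unshiftNegatives n (shiftNegatives n π) ≡ π
  unshift∘shift≡id = rotate-inverse std cycleSucc∘cyclePred cyclePred∘cycleSucc

  shift∘unshift≡id : shiftNegatives n (unshiftNegatives n π) ≡ π
  shift∘unshift≡id = rotate-inverse std cyclePred∘cycleSucc cycleSucc∘cyclePred

  NormalMergeRel-shift⇔MergeRel : ∀ i → suc i < k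
    → NormalMergeRel (block (shiftNegatives n π) i) (block (shiftNegatives n π) (suc i))
      ⇔ MergeRel (block π i) (block π (suc i))
  NormalMergeRel-shift⇔MergeRel i 1+i<k = mk⇔ from to
    where
    i<k = ℕP.<⇒≤ 1+i<k
    π′ = shiftNegatives n π

    +mins-∈′ : ∀ j → j < k → + mins π j ∈ block π′ j
    +mins-∈′ j j<k = Equivalence.from (∈-rotate⇔ j<k) (+mins-∈ j j<k)

    to : MergeRel (block π i) (block π (suc i)) → NormalMergeRel (block π′ i) (block π′ (suc i))
    to merge = <⇒NormalMergeRel (+mins-∈′ i i<k) (+mins-∈′ (suc i) 1+i<k) λ x∈ y∈ →
      increasing (Equivalence.to (∈-rotate⇔ i<k) x∈) (Equivalence.to (∈-rotate⇔ 1+i<k) y∈)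
      where
      below-next : ∀ {b} → b ∈ block π i → ∣ b ∣ < mins π (suc i)
      below-next b∈ = ℕP.≤-<-trans (≤-maxAbs b∈) merge
      increasing : ∀ {x y} → Rotated cyclePred π i x → Rotated cyclePred π (suc i) y → x ℤ.< y
      increasing {+ _} {+ _} x∈ y∈ = ℤ.+<+ (ℕP.<-≤-trans (below-next x∈) (minAbs-≤ y∈))
      increasing { -[1+ _ ]} {+ _} _ _ = ℤ.-<+
      increasing {_} { -[1+ m ]} _ (1+i<c , y∈) =
        ⊥-elim (ℕP.<-asym (below-next y∈) (proj₂ (Equivalence.to (<-below⇔ (suc m) (suc i)) 1+i<c)))

    from : NormalMergeRel (block π′ i) (block π′ (suc i)) → MergeRel (block π i) (block π (suc i))
    from normal = maxAbs-<⁺ (mins-positive (suc i) 1+i<k) below-next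
      where
      below-next : ∀ {b} → b ∈ block π i → ∣ b ∣ < mins π (suc i)
      below-next {+ m} b∈
        with NormalMergeRel⇒< normal (Equivalence.from (∈-rotate⇔ i<k) b∈) (+mins-∈′ (suc i) 1+i<k)
      ... | ℤ.+<+ m<next = m<next
      below-next { -[1+ m ]} b∈ with ℕP.<-cmp (suc m) (mins π (suc i))
      ... | tri< b<next _ _ = b<next
      ... | tri≈ _ b≡next _ with abs-injective b∈ (+mins-∈ (suc i) 1+i<k) b≡next
      ...   | () , _
      below-next { -[1+ m ]} b∈ | tri> _ _ next<b
        with NormalMergeRel⇒< normal (+mins-∈′ i i<k) (Equivalence.from (∈-rotate⇔ 1+i<k)
               (Equivalence.from (<-below⇔ (suc m) (suc i)) (1+i<k , next<b) , b∈))
      ... | ()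

  normalMergeCount-shiftNegatives : normalMergeCount (shiftNegatives n π) ≡ mergeCount π
  normalMergeCount-shiftNegatives = countAdj-block-cong _ _ (shiftNegatives n π) π length-rotate λ i 1+i<k →
    NormalMergeRel-shift⇔MergeRel i (subst (suc i <_) length-rotate 1+i<k)

mainTheorem7 : (n : ℕ) → 1 ≤ n → (r : ℕ) → (xs ys : List SPart)
    → Unique xs → (∀ π → (π ∈ xs) ⇔ (StdForm n π × mergeCount π ≡ r))
    → Unique ys → (∀ π → (π ∈ ys) ⇔ (StdForm n π × normalMergeCount π ≡ r))
    → length xs ≡ length ys
mainTheorem7 n _ r _ _ = length-≡-of-inverses (shiftNegatives n) (unshiftNegatives n)
  (λ (std , count) → shiftNegatives-std std , trans (normalMergeCount-shiftNegatives std) count)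
  (λ (std , count) → unshiftNegatives-std std , unshifted-count std count)
  (λ (std , _) → unshift∘shift≡id std)
  (λ (std , _) → shift∘unshift≡id std)
  where
  unshifted-count : ∀ {π} → StdForm n π → normalMergeCount π ≡ r → mergeCount (unshiftNegatives n π) ≡ r
  unshifted-count {π} std count = begin
    mergeCount (unshiftNegatives n π)
      ≡⟨ normalMergeCount-shiftNegatives (unshiftNegatives-std std) ⟨
    normalMergeCount (shiftNegatives n (unshiftNegatives n π))
      ≡⟨ cong normalMergeCount (shift∘unshift≡id std) ⟩
    normalMergeCount π
      ≡⟨ count ⟩
    r ∎
    where open ≡-Reasoning
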